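{- Let $d\ge0$, $m=2^d$, and let $M=M_d^{n_1,\dots,n_m}$ for some admissible sequence $n_1,\dots,n_m$. Let $\ell,k$ be integers with $0\le\ell<\ell+k\le 2^d$. Then the $k\times k$ submatrix of $M$ formed by the rows $\ell+1,\ell+2,\dots,\ell+k$ and the last $k$ columns $2^d-k+1,\dots,2^d$ is invertible over $\mathbb{F}_2$.
   Context: Matrices over $\mathbb{F}_2$: $M_0=(1)$ and $M_{d+1}=\begin{pmatrix}M_d&M_d\\0&M_d\end{pmatrix}$, so $M_d$ is $2^d\times2^d$. Let $\sigma$ map a column vector $(a_1,\dots,a_n)^t$ to $(a_n,a_1,\dots,a_{n-1})^t$. A sequence of integers $n_1,\dots,n_m$ is admissible if $n_m=0$ and $n_{i+1}\le n_i\le n_{i+1}+1$ for $1\le i<m$. With $C_1,\dots,C_m$ the columns of $M_d$, $M_d^{n_1,\dots,n_m}$ is the matrix with columns $\sigma^{n_1}(C_1),\dots,\sigma^{n_m}(C_m)$. -}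

module Defs where

open import Data.Bool using (Bool; true; false; _xor_; _∧_; if_then_else_)
open import Data.Nat using (ℕ; zero; suc; _+_; _∸_; _^_; _≤_; _<_; _<ᵇ_)
open import Data.Nat.Properties using (+-monoʳ-<; <-≤-trans; m∸n+n≡m; ≤-refl; ≤-trans; m≤n+m)
open import Data.Fin using (Fin; zero; suc; toℕ; fromℕ; fromℕ<; inject₁)
open import Data.Fin.Properties using (toℕ<n)
open import Data.Product using (Σ; _×_)
open import Function using (_∘_)
open import Relation.Binary.PropositionalEquality using (_≡_; subst; sym)

-- Field F₂ modelled by Bool: addition = xor, multiplication = ∧.

-- Entries of M_d, 0-indexed by naturals (meaningful for i, j < 2^d).
-- M_0 = (1);  M_{d+1} = [[M_d, M_d], [0, M_d]].
Mentry : ℕ → ℕ → ℕ → Bool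
Mentry zero    i j = true
Mentry (suc d) i j with i <ᵇ 2 ^ d | j <ᵇ 2 ^ d
... | true  | true  = Mentry d i j
... | true  | false = Mentry d i (j ∸ 2 ^ d)
... | false | true  = false
... | false | false = Mentry d (i ∸ 2 ^ d) (j ∸ 2 ^ d)

M : (d : ℕ) → Fin (2 ^ d) → Fin (2 ^ d) → Bool
M d i j = Mentry d (toℕ i) (toℕ j)

σ : ∀ {A : Set} {n : ℕ} → (Fin n → A) → (Fin n → A)
σ {n = zero}  v ()
σ {n = suc n} v zero    = v (fromℕ n)
σ {n = suc n} v (suc i) = v (inject₁ i)

σ^ : ∀ {A : Set} {n : ℕ} → ℕ → (Fin n → A) → (Fin n → A)
σ^ zero    v = v
σ^ (suc k) v = σ (σ^ k v)

-- Admissible sequence n₁,…,n_m indexed by Fin m (0-based):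
-- n_m = 0 and n_{i+1} ≤ n_i ≤ n_{i+1} + 1.
-- (Integers: admissibility forces nonnegativity, so ℕ loses nothing.)
Admissible : (m : ℕ) → (Fin m → ℕ) → Set
Admissible m ns =
  (∀ (i : Fin m) → suc (toℕ i) ≡ m → ns i ≡ 0) ×
  (∀ (i j : Fin m) → toℕ j ≡ suc (toℕ i) → (ns j ≤ ns i) × (ns i ≤ ns j + 1))

Mshift : (d : ℕ) → (Fin (2 ^ d) → ℕ) → Fin (2 ^ d) → Fin (2 ^ d) → Bool
Mshift d ns i j = σ^ (ns j) (λ r → M d r j) i

Mat : ℕ → Set
Mat k = Fin k → Fin k → Bool

sumF2 : ∀ {k : ℕ} → (Fin k → Bool) → Bool
sumF2 {zero}  f = false
sumF2 {suc k} f = f zero xor sumF2 (f ∘ suc)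

_⊗_ : ∀ {k : ℕ} → Mat k → Mat k → Mat k
(A ⊗ B) i j = sumF2 (λ r → A i r ∧ B r j)

identity : ∀ {k : ℕ} → Mat k
identity zero    zero    = true
identity zero    (suc j) = false
identity (suc i) zero    = false
identity (suc i) (suc j) = identity i j

Invertible : ∀ {k : ℕ} → Mat k → Set
Invertible {k} A = Σ (Mat k) λ B →
  (∀ i j → (A ⊗ B) i j ≡ identity i j) × (∀ i j → (B ⊗ A) i j ≡ identity i j)

rowIdx : ∀ {m} (ℓ k : ℕ) → ℓ + k ≤ m → Fin k → Fin m
rowIdx ℓ k h a = fromℕ< (<-≤-trans (+-monoʳ-< ℓ (toℕ<n a)) h)

colIdx : ∀ {m} (ℓ k : ℕ) → ℓ + k ≤ m → Fin k → Fin m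
colIdx {m} ℓ k h a = fromℕ< {(m ∸ k) + toℕ a} (<-≤-trans (+-monoʳ-< (m ∸ k) (toℕ<n a))
  (subst (_≤ m) (sym (m∸n+n≡m (k≤m ℓ k h))) (≤-refl)))
  where
  k≤m : ∀ {m} ℓ k → ℓ + k ≤ m → k ≤ m
  k≤m ℓ k h = ≤-trans (m≤n+m k ℓ) h

-- The k×k submatrix of A with rows ℓ+1,…,ℓ+k and the last k columns (1-based).
subMat : ∀ {m} (A : Fin m → Fin m → Bool) (ℓ k : ℕ) → ℓ + k ≤ m → Mat k
subMat A ℓ k h a b = A (rowIdx ℓ k h a) (colIdx ℓ k h b)

{-# OPTIONS --safe #-}

-- Index rows and columns from 0, put m = 2^d, and read columns as sequences on ℤ/m, with σ the
-- rotation and Δ = 1 + σ the cyclic difference operator over F₂. The columns of M_d obey Pascal's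
-- rule C_(j+1) = Δ C_j, so C_j = Δ^j C_0, and the last column Δ^(m-1) C_0 is all ones; hence
-- Δ^a C_0 = 0 for a ≥ m. As Δ commutes with σ, a kernel vector v of the submatrix gives a sequence
-- q = Σ_b v_b σ^(n_b) C_(m-k+b) with Δ^k q = 0 that vanishes on the k consecutive rows ℓ, …, ℓ+k-1,
-- and such a q is 0 (by induction on k: Δ q is such a sequence for k-1, and the kernel of Δ consists
-- of the constants). Applying Δ^(k-1) to q = 0 leaves v_0 times the all-ones sequence, so v_0 = 0,
-- and induction on k gives v = 0. A square matrix over the finite field F₂ with trivial kernel is
-- invertible.

module Submission where

open import Defs
open import Algebra.Bundles using (CommutativeRing)
open import Data.Bool using (Bool; true; false; _xor_; _∧_)
open import Data.Bool.Properties
  using (xor-∧-commutativeRing; xor-same; xor-identityʳ; ∧-assoc; ∧-identityʳ; ∧-zeroʳ;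
         ∧-distribˡ-xor; ∧-distribʳ-xor; T-≡)
open import Data.Fin using (Fin; zero; suc; toℕ; fromℕ; inject₁; punchOut; funToFin; finToFun; combine)
open import Data.Fin.Properties
  using (2↔Bool; _≟_; any?; injective⇒≤; punchOut-injective; funToFin-finToFin; finToFun-funToFin;
         toℕ<n; toℕ-fromℕ; toℕ-inject₁; toℕ-fromℕ<)
open import Data.Nat
  using (ℕ; zero; suc; pred; _+_; _∸_; _^_; _≤_; _<_; _<ᵇ_; _<?_; NonZero; s≤s; z<s; >-nonZero⁻¹)
open import Data.Nat.Properties
  using (≤-reflexive; ≤-trans; <⇒≤; ≮⇒≥; <-irrefl; n<1+n; m≤m+n; m≤n+m; m≤n⇒m≤1+n; m<m+n;
         m≤n⇒m<n∨m≡n; +-suc; +-comm; +-assoc; +-identityʳ; +-cancelˡ-<; +-monoʳ-≤; +-monoˡ-≤;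
         <-≤-trans; m+[n∸m]≡n; m∸n+n≡m; m+n∸m≡n; suc-pred; m^n≢0; m^n>0; <⇒<ᵇ; module ≤-Reasoning)
open import Data.Product using (∃; _,_; proj₁; proj₂)
open import Data.Sum using (inj₁; inj₂)
open import Data.Vec.Functional using (Vector)
open import Function using (_∘_; Inverse; Equivalence)
open import Function.Definitions using (Injective)
open import Level using (0ℓ)
open import Relation.Binary.Bundles using (Setoid)
import Relation.Binary.Reasoning.Setoid as SetoidReasoning
open import Relation.Binary.PropositionalEquality
  using (_≡_; _≢_; _≗_; refl; sym; trans; cong; cong₂; subst; module ≡-Reasoning)
open import Relation.Nullary using (yes; no; contradiction)
open import Algebra.Properties.Semiring.Sum (CommutativeRing.semiring xor-∧-commutativeRing)
  using (sum; sum-cong-≗; sum-replicate-zero; ∑-distrib-+; ∑-comm; *-distribˡ-sum; *-distribʳ-sum)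

-- Linear algebra over F₂

sumF2≡sum : ∀ {k} (f : Vector Bool k) → sumF2 f ≡ sum f
sumF2≡sum {zero}  f = refl
sumF2≡sum {suc k} f = cong (f zero xor_) (sumF2≡sum (f ∘ suc))

xor≡false⇒≡ : ∀ {x y} → x xor y ≡ false → x ≡ y
xor≡false⇒≡ {false} {false} _  = refl
xor≡false⇒≡ {false} {true}  ()
xor≡false⇒≡ {true}  {false} ()
xor≡false⇒≡ {true}  {true}  _  = refl

infixr 8 _·_

_·_ : ∀ {k} → Mat k → Vector Bool k → Vector Bool k
(A · v) i = sum (λ r → A i r ∧ v r)

·-distrib-xor : ∀ {k} (A : Mat k) (v w : Vector Bool k) →
                A · (λ r → v r xor w r) ≗ (λ i → (A · v) i xor (A · w) i)
·-distrib-xor A v w i = trans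
  (sum-cong-≗ (λ r → ∧-distribˡ-xor (A i r) (v r) (w r)))
  (∑-distrib-+ (λ r → A i r ∧ v r) (λ r → A i r ∧ w r))

∑-identityˡ : ∀ {k} (i : Fin k) (v : Vector Bool k) → sum (λ r → identity i r ∧ v r) ≡ v i
∑-identityˡ {suc k} zero    v = trans (cong (v zero xor_) (sum-replicate-zero k)) (xor-identityʳ (v zero))
∑-identityˡ {suc k} (suc i) v = ∑-identityˡ i (v ∘ suc)

∑-identityʳ : ∀ {k} (v : Vector Bool k) (j : Fin k) → sum (λ r → v r ∧ identity r j) ≡ v j
∑-identityʳ {suc k} v zero    = begin
  (v zero ∧ true) xor sum (λ r → v (suc r) ∧ false)
    ≡⟨ cong₂ _xor_ (∧-identityʳ (v zero)) (sum-cong-≗ {k} (∧-zeroʳ ∘ v ∘ suc)) ⟩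
  v zero xor sum {k} (λ _ → false)
    ≡⟨ cong (v zero xor_) (sum-replicate-zero k) ⟩
  v zero xor false
    ≡⟨ xor-identityʳ (v zero) ⟩
  v zero ∎
  where open ≡-Reasoning
∑-identityʳ {suc k} v (suc j) =
  trans (cong (_xor sum (λ r → v (suc r) ∧ identity r j)) (∧-zeroʳ (v zero))) (∑-identityʳ (v ∘ suc) j)

·-·-assoc : ∀ {k} (A B : Mat k) (w : Vector Bool k) →
            A · B · w ≗ (λ i → sum (λ r → (A ⊗ B) i r ∧ w r))
·-·-assoc A B w i = begin
  sum (λ s → A i s ∧ sum (λ r → B s r ∧ w r))
    ≡⟨ sum-cong-≗ (λ s → *-distribˡ-sum (A i s) (λ r → B s r ∧ w r)) ⟩
  sum (λ s → sum (λ r → A i s ∧ (B s r ∧ w r)))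
    ≡⟨ ∑-comm (λ s r → A i s ∧ (B s r ∧ w r)) ⟩
  sum (λ r → sum (λ s → A i s ∧ (B s r ∧ w r)))
    ≡⟨ sum-cong-≗ (λ r → sum-cong-≗ (λ s → sym (∧-assoc (A i s) (B s r) (w r)))) ⟩
  sum (λ r → sum (λ s → (A i s ∧ B s r) ∧ w r))
    ≡⟨ sum-cong-≗ (λ r → sym (*-distribʳ-sum (w r) (λ s → A i s ∧ B s r))) ⟩
  sum (λ r → sum (λ s → A i s ∧ B s r) ∧ w r)
    ≡⟨ sum-cong-≗ (λ r → cong (_∧ w r) (sym (sumF2≡sum (λ s → A i s ∧ B s r)))) ⟩
  sum (λ r → (A ⊗ B) i r ∧ w r) ∎
  where open ≡-Reasoning

TrivialKernel : ∀ {k} → Mat k → Set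
TrivialKernel {k} A = ∀ (v : Vector Bool k) → (∀ i → (A · v) i ≡ false) → ∀ i → v i ≡ false

·-injective : ∀ {k} {A : Mat k} → TrivialKernel A → ∀ {v w} → A · v ≗ A · w → v ≗ w
·-injective {A = A} ker {v} {w} Av≗Aw = xor≡false⇒≡ ∘ ker (λ r → v r xor w r) A[v+w]≡0
  where
  A[v+w]≡0 : ∀ i → (A · (λ r → v r xor w r)) i ≡ false
  A[v+w]≡0 i = trans (·-distrib-xor A v w i) (trans (cong (_xor (A · w) i) (Av≗Aw i)) (xor-same ((A · w) i)))

injective⇒surjective : ∀ {n} (f : Fin n → Fin n) → Injective _≡_ _≡_ f → ∀ y → ∃ λ x → f x ≡ y
injective⇒surjective {suc n} f f-inj y with any? (λ x → f x ≟ y)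
... | yes found = found
... | no ¬found = contradiction (injective⇒≤ g-inj) (<-irrefl refl)
  where
  y≢f : ∀ x → y ≢ f x
  y≢f x y≡fx = ¬found (x , sym y≡fx)
  g : Fin (suc n) → Fin n
  g x = punchOut (y≢f x)
  g-inj : Injective _≡_ _≡_ g
  g-inj {x} {x′} gx≡gx′ = f-inj (punchOut-injective (y≢f x) (y≢f x′) gx≡gx′)

module BoolVectorEncoding where
  open Inverse 2↔Bool using (to; from; strictlyInverseˡ; strictlyInverseʳ)

  funToFin-cong : ∀ {m n} {f g : Fin m → Fin n} → f ≗ g → funToFin f ≡ funToFin g
  funToFin-cong {zero}  f≗g = refl
  funToFin-cong {suc m} f≗g = cong₂ combine (f≗g zero) (funToFin-cong (f≗g ∘ suc))

  encode : ∀ {k} → Vector Bool k → Fin (2 ^ k)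
  encode v = funToFin (from ∘ v)

  decode : ∀ {k} → Fin (2 ^ k) → Vector Bool k
  decode x = to ∘ finToFun x

  decode-encode : ∀ {k} (v : Vector Bool k) → decode (encode v) ≗ v
  decode-encode v i = trans (cong to (finToFun-funToFin (from ∘ v) i)) (strictlyInverseˡ (v i))

  encode-decode : ∀ {k} (x : Fin (2 ^ k)) → encode {k} (decode x) ≡ x
  encode-decode {k} x =
    trans (funToFin-cong {k} (strictlyInverseʳ ∘ finToFun x)) (funToFin-finToFin {k} {2} x)

  encode-cong : ∀ {k} {v w : Vector Bool k} → v ≗ w → encode v ≡ encode w
  encode-cong v≗w = funToFin-cong (cong from ∘ v≗w)

open BoolVectorEncoding using (encode; decode; decode-encode; encode-decode; encode-cong)

injective⇒surjective-≗ : ∀ {k} (F : Vector Bool k → Vector Bool k) →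
                         (∀ {v w} → F v ≗ F w → v ≗ w) → ∀ w → ∃ λ v → F v ≗ w
injective⇒surjective-≗ {k} F F-inj w = decode x , λ i → begin
  F (decode x) i                   ≡⟨ decode-encode (F (decode x)) i ⟨
  decode (encode (F (decode x))) i ≡⟨ cong (λ y → decode y i) Gx≡w ⟩
  decode (encode w) i              ≡⟨ decode-encode w i ⟩
  w i                              ∎
  where
  open ≡-Reasoning
  G : Fin (2 ^ k) → Fin (2 ^ k)
  G = encode ∘ F ∘ decode
  G-inj : Injective _≡_ _≡_ G
  G-inj {x} {y} Gx≡Gy = begin
    x                     ≡⟨ encode-decode {k} x ⟨
    encode {k} (decode x) ≡⟨ encode-cong (F-inj Fx≗Fy) ⟩
    encode {k} (decode y) ≡⟨ encode-decode {k} y ⟩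
    y                     ∎
    where
    Fx≗Fy : F (decode x) ≗ F (decode y)
    Fx≗Fy i = trans (sym (decode-encode _ i)) (trans (cong (λ z → decode z i) Gx≡Gy) (decode-encode _ i))
  x : Fin (2 ^ k)
  x = proj₁ (injective⇒surjective G G-inj (encode w))
  Gx≡w : G x ≡ encode w
  Gx≡w = proj₂ (injective⇒surjective G G-inj (encode w))

trivialKernel⇒invertible : ∀ {k} (A : Mat k) → TrivialKernel A → Invertible A
trivialKernel⇒invertible {k} A ker = B , AB≡I , BA≡I
  where
  unit : Fin k → Vector Bool k
  unit j r = identity r j
  solve : ∀ w → ∃ λ v → A · v ≗ w
  solve = injective⇒surjective-≗ (A ·_) (·-injective ker)
  B : Mat k
  B r j = proj₁ (solve (unit j)) r
  AB≡I : ∀ i j → (A ⊗ B) i j ≡ identity i j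
  AB≡I i j = trans (sumF2≡sum (λ r → A i r ∧ B r j)) (proj₂ (solve (unit j)) i)
  BA≡I : ∀ i j → (B ⊗ A) i j ≡ identity i j
  BA≡I i j = trans (sumF2≡sum (λ r → B i r ∧ A r j)) (·-injective ker A·B·Aⱼ≗A·eⱼ i)
    where
    open ≡-Reasoning
    Aⱼ : Vector Bool k
    Aⱼ r = A r j
    A·B·Aⱼ≗A·eⱼ : A · B · Aⱼ ≗ A · unit j
    A·B·Aⱼ≗A·eⱼ i′ = begin
      (A · B · Aⱼ) i′                     ≡⟨ ·-·-assoc A B Aⱼ i′ ⟩
      sum (λ r → (A ⊗ B) i′ r ∧ A r j)   ≡⟨ sum-cong-≗ (λ r → cong (_∧ A r j) (AB≡I i′ r)) ⟩
      sum (λ r → identity i′ r ∧ A r j)  ≡⟨ ∑-identityˡ i′ Aⱼ ⟩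
      A i′ j                              ≡⟨ ∑-identityʳ (A i′) j ⟨
      (A · unit j) i′                     ∎

-- Sequences on ℤ/m and the difference operator Δ

Seq : Set
Seq = ℕ → Bool

zeros ones : Seq
zeros _ = false
ones  _ = true

linComb : ∀ {k} → (Fin k → Seq) → Vector Bool k → Seq
linComb f v i = sum (λ b → f b i ∧ v b)

module Cyclic (m : ℕ) .{{_ : NonZero m}} where

  predMod : ℕ → ℕ
  predMod zero    = pred m
  predMod (suc i) = i

  predMod-< : ∀ {i} → i < m → predMod i < m
  predMod-< {zero}  _     = subst (pred m <_) (suc-pred m) (n<1+n (pred m))
  predMod-< {suc i} i+1<m = <⇒≤ i+1<m

  rotate : Seq → Seq
  rotate v i = v (predMod i)

  rotate^ : ℕ → Seq → Seq
  rotate^ zero    v = v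
  rotate^ (suc n) v = rotate (rotate^ n v)

  Δ : Seq → Seq
  Δ v i = v i xor rotate v i

  Δ^ : ℕ → Seq → Seq
  Δ^ zero    v = v
  Δ^ (suc k) v = Δ (Δ^ k v)

  -- A sequence stands for the vector of its values on [0, m); values beyond m are junk.
  infix 4 _≈_

  _≈_ : Seq → Seq → Set
  v ≈ w = ∀ i → i < m → v i ≡ w i

  ≈-setoid : Setoid 0ℓ 0ℓ
  ≈-setoid = record
    { Carrier       = Seq
    ; _≈_           = _≈_
    ; isEquivalence = record
      { refl  = λ _ _ → refl
      ; sym   = λ v≈w i i<m → sym (v≈w i i<m)
      ; trans = λ u≈v v≈w i i<m → trans (u≈v i i<m) (v≈w i i<m)
      }
    }

  open Setoid ≈-setoid public using () renaming (refl to ≈-refl; sym to ≈-sym; trans to ≈-trans)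
  module ≈-Reasoning = SetoidReasoning ≈-setoid

  rotate-cong : ∀ {v w} → v ≈ w → rotate v ≈ rotate w
  rotate-cong v≈w i i<m = v≈w (predMod i) (predMod-< i<m)

  rotate^-cong : ∀ n {v w} → v ≈ w → rotate^ n v ≈ rotate^ n w
  rotate^-cong zero    v≈w = v≈w
  rotate^-cong (suc n) v≈w = rotate-cong (rotate^-cong n v≈w)

  Δ-cong : ∀ {v w} → v ≈ w → Δ v ≈ Δ w
  Δ-cong v≈w i i<m = cong₂ _xor_ (v≈w i i<m) (rotate-cong v≈w i i<m)

  Δ^-cong : ∀ k {v w} → v ≈ w → Δ^ k v ≈ Δ^ k w
  Δ^-cong zero    v≈w = v≈w
  Δ^-cong (suc k) v≈w = Δ-cong (Δ^-cong k v≈w)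

  rotate^-zeros : ∀ n → rotate^ n zeros ≡ zeros
  rotate^-zeros zero    = refl
  rotate^-zeros (suc n) = cong rotate (rotate^-zeros n)

  rotate^-ones : ∀ n → rotate^ n ones ≡ ones
  rotate^-ones zero    = refl
  rotate^-ones (suc n) = cong rotate (rotate^-ones n)

  Δ^-zeros : ∀ k → Δ^ k zeros ≡ zeros
  Δ^-zeros zero    = refl
  Δ^-zeros (suc k) = cong Δ (Δ^-zeros k)

  Δ^-+ : ∀ a b v → Δ^ (a + b) v ≡ Δ^ a (Δ^ b v)
  Δ^-+ zero    b v = refl
  Δ^-+ (suc a) b v = cong Δ (Δ^-+ a b v)

  Δ^-Δ : ∀ k v → Δ^ k (Δ v) ≡ Δ (Δ^ k v)
  Δ^-Δ k v = trans (sym (Δ^-+ k 1 v)) (cong (λ n → Δ^ n v) (+-comm k 1))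

  Δ^-rotate : ∀ k v → Δ^ k (rotate v) ≡ rotate (Δ^ k v)
  Δ^-rotate zero    v = refl
  Δ^-rotate (suc k) v = cong Δ (Δ^-rotate k v)

  Δ^-rotate^ : ∀ k n v → Δ^ k (rotate^ n v) ≡ rotate^ n (Δ^ k v)
  Δ^-rotate^ k zero    v = refl
  Δ^-rotate^ k (suc n) v = trans (Δ^-rotate k (rotate^ n v)) (cong rotate (Δ^-rotate^ k n v))

  Δ-linComb : ∀ {k} (f : Fin k → Seq) (v : Vector Bool k) → Δ (linComb f v) ≗ linComb (Δ ∘ f) v
  Δ-linComb f v i = sym (trans
    (sum-cong-≗ (λ b → ∧-distribʳ-xor (v b) (f b i) (f b (predMod i))))
    (∑-distrib-+ (λ b → f b i ∧ v b) (λ b → f b (predMod i) ∧ v b)))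

  Δ^-linComb : ∀ n {k} (f : Fin k → Seq) (v : Vector Bool k) → Δ^ n (linComb f v) ≈ linComb (Δ^ n ∘ f) v
  Δ^-linComb zero    f v = ≈-refl
  Δ^-linComb (suc n) f v i i<m = trans (Δ-cong (Δ^-linComb n f v) i i<m) (Δ-linComb (Δ^ n ∘ f) v i)

  linComb-cong : ∀ {k} {f g : Fin k → Seq} (v : Vector Bool k) →
                 (∀ b → f b ≈ g b) → linComb f v ≈ linComb g v
  linComb-cong v f≈g i i<m = sum-cong-≗ (λ b → cong (_∧ v b) (f≈g b i i<m))

  linComb-zeros : ∀ {k} {f : Fin k → Seq} (v : Vector Bool k) →
                  (∀ b → f b ≈ zeros) → linComb f v ≈ zeros
  linComb-zeros {k} v f≈0 i i<m = trans (linComb-cong v f≈0 i i<m) (sum-replicate-zero k)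

  Δ-kernel-constant : ∀ q → Δ q ≈ zeros → ∀ i → i < m → q i ≡ q 0
  Δ-kernel-constant q Δq≈0 zero    _     = refl
  Δ-kernel-constant q Δq≈0 (suc i) i+1<m =
    trans (xor≡false⇒≡ (Δq≈0 (suc i) i+1<m)) (Δ-kernel-constant q Δq≈0 i (<⇒≤ i+1<m))

  window-vanishing : ∀ ℓ k {q} → ℓ + k ≤ m → Δ^ k q ≈ zeros →
                     (∀ (a : Fin k) → q (ℓ + toℕ a) ≡ false) → q ≈ zeros
  window-vanishing ℓ zero    _       Δ⁰q≈0 _   = Δ⁰q≈0
  window-vanishing ℓ (suc k) {q} ℓ+k≤m Δᵏq≈0 q≡0 i i<m = begin
    q i      ≡⟨ Δ-kernel-constant q Δq≈0 i i<m ⟩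
    q 0      ≡⟨ Δ-kernel-constant q Δq≈0 ℓ ℓ<m ⟨
    q ℓ      ≡⟨ cong q (+-identityʳ ℓ) ⟨
    q (ℓ + 0) ≡⟨ q≡0 zero ⟩
    false    ∎
    where
    open ≡-Reasoning
    ℓ<m : ℓ < m
    ℓ<m = <-≤-trans (m<m+n ℓ z<s) ℓ+k≤m
    Δq-window : ∀ (a : Fin k) → Δ q (suc ℓ + toℕ a) ≡ false
    Δq-window a = cong₂ _xor_
      (trans (cong q (sym (+-suc ℓ (toℕ a)))) (q≡0 (suc a)))
      (trans (cong (λ x → q (ℓ + x)) (sym (toℕ-inject₁ a))) (q≡0 (inject₁ a)))
    Δq≈0 : Δ q ≈ zeros
    Δq≈0 = window-vanishing (suc ℓ) k (subst (_≤ m) (+-suc ℓ k) ℓ+k≤m)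
             (subst (_≈ zeros) (sym (Δ^-Δ k q)) Δᵏq≈0) Δq-window

  Δ^-beyond : ∀ {e} → Δ^ (pred m) e ≈ ones → ∀ a → m ≤ a → Δ^ a e ≈ zeros
  Δ^-beyond {e} last a m≤a = begin
    Δ^ a e                         ≡⟨ cong (λ x → Δ^ x e) (m∸n+n≡m m≤a) ⟨
    Δ^ (a ∸ m + m) e               ≡⟨ Δ^-+ (a ∸ m) m e ⟩
    Δ^ (a ∸ m) (Δ^ m e)            ≡⟨ cong (λ x → Δ^ (a ∸ m) (Δ^ x e)) (suc-pred m) ⟨
    Δ^ (a ∸ m) (Δ (Δ^ (pred m) e)) ≈⟨ Δ^-cong (a ∸ m) (Δ-cong last) ⟩
    Δ^ (a ∸ m) zeros               ≡⟨ Δ^-zeros (a ∸ m) ⟩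
    zeros                          ∎
    where open ≈-Reasoning

  Δ^-rotate^-Δ^ : ∀ k n a e → Δ^ k (rotate^ n (Δ^ a e)) ≡ rotate^ n (Δ^ (a + k) e)
  Δ^-rotate^-Δ^ k n a e = trans (Δ^-rotate^ k n (Δ^ a e))
    (cong (rotate^ n) (trans (sym (Δ^-+ k a e)) (cong (λ x → Δ^ x e) (+-comm k a))))

  Δ^-rotate^-last : ∀ {e} → Δ^ (pred m) e ≈ ones →
                    ∀ k n a → a + k ≡ pred m → Δ^ k (rotate^ n (Δ^ a e)) ≈ ones
  Δ^-rotate^-last {e} last k n a a+k≡pred[m] = begin
    Δ^ k (rotate^ n (Δ^ a e))  ≡⟨ Δ^-rotate^-Δ^ k n a e ⟩
    rotate^ n (Δ^ (a + k) e)   ≡⟨ cong (λ x → rotate^ n (Δ^ x e)) a+k≡pred[m] ⟩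
    rotate^ n (Δ^ (pred m) e)  ≈⟨ rotate^-cong n last ⟩
    rotate^ n ones             ≡⟨ rotate^-ones n ⟩
    ones                       ∎
    where open ≈-Reasoning

  Δ^-rotate^-beyond : ∀ {e} → Δ^ (pred m) e ≈ ones →
                      ∀ k n a → m ≤ a + k → Δ^ k (rotate^ n (Δ^ a e)) ≈ zeros
  Δ^-rotate^-beyond {e} last k n a m≤a+k = begin
    Δ^ k (rotate^ n (Δ^ a e))  ≡⟨ Δ^-rotate^-Δ^ k n a e ⟩
    rotate^ n (Δ^ (a + k) e)   ≈⟨ rotate^-cong n (Δ^-beyond last (a + k) m≤a+k) ⟩
    rotate^ n zeros            ≡⟨ rotate^-zeros n ⟩
    zeros                      ∎
    where open ≈-Reasoning

  rotated-Δ^-independent : ∀ {e} → Δ^ (pred m) e ≈ ones → ∀ p k (shift : Fin k → ℕ) (v : Vector Bool k) →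
    p + k ≡ m → linComb (λ b → rotate^ (shift b) (Δ^ (p + toℕ b) e)) v ≈ zeros → ∀ b → v b ≡ false
  rotated-Δ^-independent         last p zero    shift v _     _      ()
  rotated-Δ^-independent {e} last p (suc k) shift v p+k≡m comb≈0 = λ where
      zero    → v₀≡0
      (suc b) → rotated-Δ^-independent last (suc p) k (shift ∘ suc) (v ∘ suc)
                  (trans (sym (+-suc p k)) p+k≡m) tail≈0 b
    where
    f : Fin (suc k) → Seq
    f b = rotate^ (shift b) (Δ^ (p + toℕ b) e)
    0<m : 0 < m
    0<m = >-nonZero⁻¹ m
    Δᵏf₀≈ones : Δ^ k (f zero) ≈ ones
    Δᵏf₀≈ones = Δ^-rotate^-last last k (shift zero) (p + 0)
      (trans (cong (_+ k) (+-identityʳ p)) (cong pred (trans (sym (+-suc p k)) p+k≡m)))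
    Δᵏfₛ≈0 : ∀ b → Δ^ k (f (suc b)) ≈ zeros
    Δᵏfₛ≈0 b = Δ^-rotate^-beyond last k (shift (suc b)) (p + suc (toℕ b)) (begin
      m                       ≡⟨ p+k≡m ⟨
      p + suc k               ≤⟨ +-monoʳ-≤ p (s≤s (m≤n+m k (toℕ b))) ⟩
      p + (suc (toℕ b) + k)   ≡⟨ +-assoc p (suc (toℕ b)) k ⟨
      p + suc (toℕ b) + k     ∎)
      where open ≤-Reasoning
    v₀≡0 : v zero ≡ false
    v₀≡0 = begin
      v zero                     ≡⟨ xor-identityʳ (v zero) ⟨
      v zero xor false           ≡⟨ cong₂ _xor_ (cong (_∧ v zero) (Δᵏf₀≈ones 0 0<m))
                                                (linComb-zeros (v ∘ suc) Δᵏfₛ≈0 0 0<m) ⟨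
      linComb (Δ^ k ∘ f) v 0     ≡⟨ Δ^-linComb k f v 0 0<m ⟨
      Δ^ k (linComb f v) 0       ≡⟨ Δ^-cong k comb≈0 0 0<m ⟩
      Δ^ k zeros 0               ≡⟨ cong (λ z → z 0) (Δ^-zeros k) ⟩
      false                      ∎
      where open ≡-Reasoning
    tail≈0 : linComb (λ b → rotate^ (shift (suc b)) (Δ^ (suc p + toℕ b) e)) (v ∘ suc) ≈ zeros
    tail≈0 i i<m = begin
      linComb (λ b → rotate^ (shift (suc b)) (Δ^ (suc p + toℕ b) e)) (v ∘ suc) i
        ≡⟨ sum-cong-≗ (λ b → cong (λ x → rotate^ (shift (suc b)) (Δ^ x e) i ∧ v (suc b)) (+-suc p (toℕ b))) ⟨
      linComb (f ∘ suc) (v ∘ suc) i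
        ≡⟨ cong (_xor linComb (f ∘ suc) (v ∘ suc) i) (trans (cong (f zero i ∧_) v₀≡0) (∧-zeroʳ (f zero i))) ⟨
      linComb f v i
        ≡⟨ comb≈0 i i<m ⟩
      false ∎
      where open ≡-Reasoning

  rotatedWindow-trivialKernel : ∀ {e} → Δ^ (pred m) e ≈ ones → ∀ ℓ k → ℓ + k ≤ m →
    (shift : Fin k → ℕ) (v : Vector Bool k) →
    (∀ (a : Fin k) → linComb (λ b → rotate^ (shift b) (Δ^ (m ∸ k + toℕ b) e)) v (ℓ + toℕ a) ≡ false) →
    ∀ b → v b ≡ false
  rotatedWindow-trivialKernel {e} last ℓ k ℓ+k≤m shift v window =
    rotated-Δ^-independent last (m ∸ k) k shift v (m∸n+n≡m k≤m)
      (window-vanishing ℓ k ℓ+k≤m Δᵏq≈0 window)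
    where
    k≤m : k ≤ m
    k≤m = ≤-trans (m≤n+m k ℓ) ℓ+k≤m
    f : Fin k → Seq
    f b = rotate^ (shift b) (Δ^ (m ∸ k + toℕ b) e)
    Δᵏq≈0 : Δ^ k (linComb f v) ≈ zeros
    Δᵏq≈0 = ≈-trans (Δ^-linComb k f v) (linComb-zeros v (λ b →
      Δ^-rotate^-beyond last k (shift b) (m ∸ k + toℕ b)
        (subst (_≤ m ∸ k + toℕ b + k) (m∸n+n≡m k≤m) (+-monoˡ-≤ k (m≤m+n (m ∸ k) (toℕ b))))))

-- Entries of M_d

suc-pred-2^ : ∀ d → suc (pred (2 ^ d)) ≡ 2 ^ d
suc-pred-2^ d = suc-pred (2 ^ d) {{m^n≢0 2 d}}

data Half (h : ℕ) : ℕ → Set where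
  first  : ∀ {i} → i < h → Half h i
  second : ∀ i → Half h (h + i)

half : ∀ h i → Half h i
half h i with i <? h
... | yes i<h = first i<h
... | no  i≮h = subst (Half h) (m+[n∸m]≡n (≮⇒≥ i≮h)) (second (i ∸ h))

data Position (h : ℕ) : ℕ → Set where
  before : ∀ {i} → suc i < h → Position h i
  seam   : ∀ {i} → suc i ≡ h → Position h i
  after  : ∀ i → Position h (h + i)

position : ∀ h i → Position h i
position h i with half h i
... | second i′ = after i′
... | first i<h with m≤n⇒m<n∨m≡n i<h
...   | inj₁ i+1<h = before i+1<h
...   | inj₂ i+1≡h = seam i+1≡h

<ᵇ-true : ∀ {i n} → i < n → (i <ᵇ n) ≡ true
<ᵇ-true = Equivalence.to T-≡ ∘ <⇒<ᵇ

<ᵇ-false : ∀ {i n} → n ≤ i → (i <ᵇ n) ≡ false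
<ᵇ-false {i}     {zero}  _         = refl
<ᵇ-false {suc i} {suc n} (s≤s n≤i) = <ᵇ-false n≤i

second-< : ∀ d {i} → 2 ^ d + i < 2 ^ suc d → i < 2 ^ d
second-< d {i} h+i<2h = subst (i <_) (+-identityʳ (2 ^ d)) (+-cancelˡ-< (2 ^ d) i _ h+i<2h)

second-suc-< : ∀ d {i} → suc (2 ^ d + i) < 2 ^ suc d → suc i < 2 ^ d
second-suc-< d {i} = second-< d ∘ subst (_< 2 ^ suc d) (sym (+-suc (2 ^ d) i))

seam-index : ∀ {i h} → suc i ≡ h → suc i ≡ h + 0
seam-index {h = h} i+1≡h = trans i+1≡h (sym (+-identityʳ h))

lastIndex-suc : ∀ d {t} → suc t ≡ 2 ^ suc d → t ≡ 2 ^ d + pred (2 ^ d)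
lastIndex-suc d {t} t+1≡2h = cong pred (begin
  suc t                        ≡⟨ t+1≡2h ⟩
  2 ^ d + (2 ^ d + 0)          ≡⟨ cong (2 ^ d +_) (trans (+-identityʳ (2 ^ d)) (sym (suc-pred-2^ d))) ⟩
  2 ^ d + suc (pred (2 ^ d))   ≡⟨ +-suc (2 ^ d) _ ⟩
  suc (2 ^ d + pred (2 ^ d))   ∎)
  where open ≡-Reasoning

M-topLeft : ∀ d {i j} → i < 2 ^ d → j < 2 ^ d → Mentry (suc d) i j ≡ Mentry d i j
M-topLeft d i<h j<h rewrite <ᵇ-true i<h | <ᵇ-true j<h = refl

M-topRight : ∀ d {i j} j′ → i < 2 ^ d → j ≡ 2 ^ d + j′ → Mentry (suc d) i j ≡ Mentry d i j′
M-topRight d j′ i<h refl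
  rewrite <ᵇ-true i<h | <ᵇ-false (m≤m+n (2 ^ d) j′) | m+n∸m≡n (2 ^ d) j′ = refl

M-bottomLeft : ∀ d {i j} → 2 ^ d ≤ i → j < 2 ^ d → Mentry (suc d) i j ≡ false
M-bottomLeft d h≤i j<h rewrite <ᵇ-false h≤i | <ᵇ-true j<h = refl

M-bottomRight : ∀ d {i j} i′ j′ → i ≡ 2 ^ d + i′ → j ≡ 2 ^ d + j′ →
                Mentry (suc d) i j ≡ Mentry d i′ j′
M-bottomRight d i′ j′ refl refl
  rewrite <ᵇ-false (m≤m+n (2 ^ d) i′) | <ᵇ-false (m≤m+n (2 ^ d) j′)
        | m+n∸m≡n (2 ^ d) i′ | m+n∸m≡n (2 ^ d) j′ = refl

M-firstRow : ∀ d j → Mentry d 0 j ≡ true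
M-firstRow zero    j = refl
M-firstRow (suc d) j with half (2 ^ d) j
... | first j<h = trans (M-topLeft d (m^n>0 2 d) j<h) (M-firstRow d j)
... | second j′ = trans (M-topRight d j′ (m^n>0 2 d) refl) (M-firstRow d j′)

M-firstColumn : ∀ d {i} → 0 < i → i < 2 ^ d → Mentry d i 0 ≡ false
M-firstColumn zero    {suc i} _   (s≤s ())
M-firstColumn (suc d) {i}     0<i i<2h with half (2 ^ d) i
... | first i<h = trans (M-topLeft d i<h (m^n>0 2 d)) (M-firstColumn d 0<i i<h)
... | second i′ = M-bottomLeft d (m≤m+n (2 ^ d) i′) (m^n>0 2 d)

M-lastColumn : ∀ d i t → i < 2 ^ d → suc t ≡ 2 ^ d → Mentry d i t ≡ true
M-lastColumn zero    i t _ _ = refl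
M-lastColumn (suc d) i t i<2h t+1≡2h with half (2 ^ d) i
... | first i<h = trans (M-topRight d (pred (2 ^ d)) i<h (lastIndex-suc d t+1≡2h))
                        (M-lastColumn d i (pred (2 ^ d)) i<h (suc-pred-2^ d))
... | second i′ = trans (M-bottomRight d i′ (pred (2 ^ d)) refl (lastIndex-suc d t+1≡2h))
                        (M-lastColumn d i′ (pred (2 ^ d)) (second-< d i<2h) (suc-pred-2^ d))

M-lastRow : ∀ d t j → suc t ≡ 2 ^ d → suc j < 2 ^ d → Mentry d t j ≡ false
M-lastRow zero    t j _ (s≤s ())
M-lastRow (suc d) t j t+1≡2h j+1<2h with half (2 ^ d) j
... | first j<h = M-bottomLeft d (≤-trans (m≤m+n (2 ^ d) _) (≤-reflexive (sym (lastIndex-suc d t+1≡2h)))) j<h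
... | second j′ = trans (M-bottomRight d (pred (2 ^ d)) j′ (lastIndex-suc d t+1≡2h) refl)
                        (M-lastRow d (pred (2 ^ d)) j′ (suc-pred-2^ d) (second-suc-< d j+1<2h))

xor-equation-cong : ∀ {e₁ e₂ e₃ x y z} → e₁ ≡ x → e₂ ≡ y → e₃ ≡ z → x ≡ y xor z → e₁ ≡ e₂ xor e₃
xor-equation-cong e₁≡x e₂≡y e₃≡z x≡y+z = trans e₁≡x (trans x≡y+z (sym (cong₂ _xor_ e₂≡y e₃≡z)))

-- The seam cases, where i + 1 or j + 1 equals 2^d, reduce to the border lemmas above.
M-pascal : ∀ d i j → suc i < 2 ^ d → suc j < 2 ^ d →
           Mentry d (suc i) (suc j) ≡ Mentry d (suc i) j xor Mentry d i j
M-pascal zero    i j (s≤s ()) _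
M-pascal (suc d) i j i+1<2h j+1<2h with position (2 ^ d) i | position (2 ^ d) j
... | before i+1<h | before j+1<h = xor-equation-cong
  (M-topLeft d i+1<h j+1<h) (M-topLeft d i+1<h (<⇒≤ j+1<h)) (M-topLeft d (<⇒≤ i+1<h) (<⇒≤ j+1<h))
  (M-pascal d i j i+1<h j+1<h)
... | before i+1<h | seam j+1≡h = xor-equation-cong
  (trans (M-topRight d 0 i+1<h (seam-index j+1≡h)) (M-firstColumn d z<s i+1<h))
  (trans (M-topLeft d i+1<h (≤-reflexive j+1≡h)) (M-lastColumn d (suc i) j i+1<h j+1≡h))
  (trans (M-topLeft d (<⇒≤ i+1<h) (≤-reflexive j+1≡h)) (M-lastColumn d i j (<⇒≤ i+1<h) j+1≡h))
  refl
... | before i+1<h | after j′ = xor-equation-cong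
  (M-topRight d (suc j′) i+1<h (sym (+-suc (2 ^ d) j′)))
  (M-topRight d j′ i+1<h refl)
  (M-topRight d j′ (<⇒≤ i+1<h) refl)
  (M-pascal d i j′ i+1<h (second-suc-< d j+1<2h))
... | seam i+1≡h | before j+1<h = xor-equation-cong
  (M-bottomLeft d (≤-reflexive (sym i+1≡h)) j+1<h) (M-bottomLeft d (≤-reflexive (sym i+1≡h)) (<⇒≤ j+1<h))
  (trans (M-topLeft d (≤-reflexive i+1≡h) (<⇒≤ j+1<h)) (M-lastRow d i j i+1≡h j+1<h))
  refl
... | seam i+1≡h | seam j+1≡h = xor-equation-cong
  (trans (M-bottomRight d 0 0 (seam-index i+1≡h) (seam-index j+1≡h)) (M-firstRow d 0))
  (M-bottomLeft d (≤-reflexive (sym i+1≡h)) (≤-reflexive j+1≡h))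
  (trans (M-topLeft d (≤-reflexive i+1≡h) (≤-reflexive j+1≡h)) (M-lastColumn d i j (≤-reflexive i+1≡h) j+1≡h))
  refl
... | seam i+1≡h | after j′ = xor-equation-cong
  (trans (M-bottomRight d 0 (suc j′) (seam-index i+1≡h) (sym (+-suc (2 ^ d) j′))) (M-firstRow d (suc j′)))
  (trans (M-bottomRight d 0 j′ (seam-index i+1≡h) refl) (M-firstRow d j′))
  (trans (M-topRight d j′ (≤-reflexive i+1≡h) refl) (M-lastRow d i j′ i+1≡h (second-suc-< d j+1<2h)))
  refl
... | after i′ | before j+1<h = xor-equation-cong
  (M-bottomLeft d (m≤n⇒m≤1+n (m≤m+n (2 ^ d) i′)) j+1<h)
  (M-bottomLeft d (m≤n⇒m≤1+n (m≤m+n (2 ^ d) i′)) (<⇒≤ j+1<h))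
  (M-bottomLeft d (m≤m+n (2 ^ d) i′) (<⇒≤ j+1<h))
  refl
... | after i′ | seam j+1≡h = xor-equation-cong
  (trans (M-bottomRight d (suc i′) 0 (sym (+-suc (2 ^ d) i′)) (seam-index j+1≡h))
         (M-firstColumn d z<s (second-suc-< d i+1<2h)))
  (M-bottomLeft d (m≤n⇒m≤1+n (m≤m+n (2 ^ d) i′)) (≤-reflexive j+1≡h))
  (M-bottomLeft d (m≤m+n (2 ^ d) i′) (≤-reflexive j+1≡h))
  refl
... | after i′ | after j′ = xor-equation-cong
  (M-bottomRight d (suc i′) (suc j′) (sym (+-suc (2 ^ d) i′)) (sym (+-suc (2 ^ d) j′)))
  (M-bottomRight d (suc i′) j′ (sym (+-suc (2 ^ d) i′)) refl)
  (M-bottomRight d i′ j′ refl refl)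
  (M-pascal d i′ j′ (second-suc-< d i+1<2h) (second-suc-< d j+1<2h))

-- Columns of M_d and its shifted submatrices

toℕ-rowIdx : ∀ {m} ℓ k (h : ℓ + k ≤ m) a → toℕ (rowIdx ℓ k h a) ≡ ℓ + toℕ a
toℕ-rowIdx ℓ k h a = toℕ-fromℕ< _

toℕ-colIdx : ∀ {m} ℓ k (h : ℓ + k ≤ m) b → toℕ (colIdx ℓ k h b) ≡ m ∸ k + toℕ b
toℕ-colIdx ℓ k h b = toℕ-fromℕ< _

column : ℕ → ℕ → Seq
column d j i = Mentry d i j

σ-rotate : ∀ {n} .{{_ : NonZero n}} (v : Fin n → Bool) (f : Seq) →
           (∀ i → v i ≡ f (toℕ i)) → ∀ i → σ v i ≡ Cyclic.rotate n f (toℕ i)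
σ-rotate {suc n} v f v≡f zero    = trans (v≡f (fromℕ n)) (cong f (toℕ-fromℕ n))
σ-rotate {suc n} v f v≡f (suc i) = trans (v≡f (inject₁ i)) (cong f (toℕ-inject₁ i))

σ^-rotate^ : ∀ {n} .{{_ : NonZero n}} k (v : Fin n → Bool) (f : Seq) →
             (∀ i → v i ≡ f (toℕ i)) → ∀ i → σ^ k v i ≡ Cyclic.rotate^ n k f (toℕ i)
σ^-rotate^ zero    v f v≡f = v≡f
σ^-rotate^ {n} (suc k) v f v≡f = σ-rotate (σ^ k v) (Cyclic.rotate^ n k f) (σ^-rotate^ k v f v≡f)

module _ (d : ℕ) where
  open Cyclic (2 ^ d) {{m^n≢0 2 d}}

  column-Δ : ∀ j → suc j < 2 ^ d → column d (suc j) ≈ Δ (column d j)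
  column-Δ j j+1<h zero    _     = trans (M-firstRow d (suc j))
    (sym (cong₂ _xor_ (M-firstRow d j) (M-lastRow d (pred (2 ^ d)) j (suc-pred-2^ d) j+1<h)))
  column-Δ j j+1<h (suc i) i+1<h = M-pascal d i j i+1<h j+1<h

  column≈Δ^ : ∀ j → j < 2 ^ d → column d j ≈ Δ^ j (column d 0)
  column≈Δ^ zero    _     = ≈-refl
  column≈Δ^ (suc j) j+1<h = ≈-trans (column-Δ j j+1<h) (Δ-cong (column≈Δ^ j (<⇒≤ j+1<h)))

  Δ^-lastColumn : Δ^ (pred (2 ^ d)) (column d 0) ≈ ones
  Δ^-lastColumn = ≈-trans (≈-sym (column≈Δ^ (pred (2 ^ d)) (predMod-< (m^n>0 2 d))))
    (λ i i<h → M-lastColumn d i (pred (2 ^ d)) i<h (suc-pred-2^ d))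

  Mshift-subMat-trivialKernel : ∀ ns ℓ k (h : ℓ + k ≤ 2 ^ d) → TrivialKernel (subMat (Mshift d ns) ℓ k h)
  Mshift-subMat-trivialKernel ns ℓ k h v S·v≡0 =
    rotatedWindow-trivialKernel Δ^-lastColumn ℓ k h shift v window
    where
    shift : Fin k → ℕ
    shift b = ns (colIdx ℓ k h b)
    entry : ∀ a b → subMat (Mshift d ns) ℓ k h a b ≡
                    rotate^ (shift b) (Δ^ (2 ^ d ∸ k + toℕ b) (column d 0)) (ℓ + toℕ a)
    entry a b = begin
      Mshift d ns r c
        ≡⟨ σ^-rotate^ {{m^n≢0 2 d}} (shift b) (λ i → M d i c) (column d (toℕ c)) (λ _ → refl) r ⟩
      rotate^ (shift b) (column d (toℕ c)) (toℕ r)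
        ≡⟨ rotate^-cong (shift b) (column≈Δ^ (toℕ c) (toℕ<n c)) (toℕ r) (toℕ<n r) ⟩
      rotate^ (shift b) (Δ^ (toℕ c) (column d 0)) (toℕ r)
        ≡⟨ cong₂ (λ x y → rotate^ (shift b) (Δ^ x (column d 0)) y) (toℕ-colIdx ℓ k h b) (toℕ-rowIdx ℓ k h a) ⟩
      rotate^ (shift b) (Δ^ (2 ^ d ∸ k + toℕ b) (column d 0)) (ℓ + toℕ a)
        ∎
      where
      open ≡-Reasoning
      r c : Fin (2 ^ d)
      r = rowIdx ℓ k h a
      c = colIdx ℓ k h b
    window : ∀ a →
      linComb (λ b → rotate^ (shift b) (Δ^ (2 ^ d ∸ k + toℕ b) (column d 0))) v (ℓ + toℕ a) ≡ false
    window a = trans (sum-cong-≗ (λ b → cong (_∧ v b) (sym (entry a b)))) (S·v≡0 a)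

lemma4 : (d : ℕ) (ns : Fin (2 ^ d) → ℕ) → Admissible (2 ^ d) ns →
         (ℓ k : ℕ) → ℓ < ℓ + k → (h : ℓ + k ≤ 2 ^ d) →
         Invertible (subMat (Mshift d ns) ℓ k h)
lemma4 d ns _ ℓ k _ h =
  trivialKernel⇒invertible (subMat (Mshift d ns) ℓ k h) (Mshift-subMat-trivialKernel d ns ℓ k h)
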